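{- Let $\mathbf A$ be an $\mathcal I$-zroupoid of type 1. Then $\mathbf A$ satisfies each of the identities (A1)–(A14): (A1) $x \to (y \to z) \approx (x \to y) \to z$; (A2) $x \to (y \to z) \approx x \to (z \to y)$; (A3) $x \to (y \to z) \approx (x \to z) \to y$; (A4) $x \to (y \to z) \approx y \to (x \to z)$; (A5) $x \to (y \to z) \approx (y \to x) \to z$; (A6) $x \to (y \to z) \approx y \to (z \to x)$; (A7) $x \to (y \to z) \approx (y \to z) \to x$; (A8) $x \to (y \to z) \approx (z \to x) \to y$; (A9) $x \to (y \to z) \approx z \to (y \to x)$; (A10) $x \to (y \to z) \approx (z \to y) \to x$; (A11) $(x \to y) \to z \approx (x \to z) \to y$; (A12) $(x \to y) \to z \approx (y \to x) \to z$; (A13) $(x \to y) \to z \approx (y \to z) \to x$; (A14) $(x \to y) \to z \approx (z \to y) \to x$.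
   Context: An $\mathcal I$-zroupoid is an algebra $\langle A,\to,0\rangle$ ($\to$ binary, $0$ constant) satisfying $(x \to y) \to z \approx [(z' \to x) \to (y \to z)']'$ and $0''\approx 0$, where $x' := x \to 0$ (prime binds tighter than $\to$). An $\mathcal I$-zroupoid $\mathbf A$ is of type 1 if it satisfies: (E1) $(x \to y)' \approx x \to (0 \to y)$; (E2) $x' \to y \approx x \to y'$; (E3) $0 \to (x \to y) \approx 0 \to (y \to x)$; (E4) $x \to (y \to z) \approx (p(x) \to p(y)) \to p(z)$, where $p$ is some (fixed) permutation of the variables $\{x,y,z\}$. -}

module Defs where

open import Level using (Level) renaming (suc to lsuc)
open import Data.Fin using (Fin; zero; suc)
open import Data.Product using (Σ; _×_; _,_)
open import Relation.Binary.PropositionalEquality using (_≡_)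
open import Function.Bundles using (_↔_; Inverse)

record Zroupoid (a : Level) : Set (lsuc a) where
  field
    Carrier : Set a
    _⇒_     : Carrier → Carrier → Carrier
    𝟎       : Carrier

  infixr 5 _⇒_
  infix 9 _′

  _′ : Carrier → Carrier
  x ′ = x ⇒ 𝟎

IsIZroupoid : ∀ {a} → Zroupoid a → Set a
IsIZroupoid Z = (∀ x y z → (x ⇒ y) ⇒ z ≡ (((z ′) ⇒ x) ⇒ ((y ⇒ z) ′)) ′)
              × (𝟎 ′) ′ ≡ 𝟎
  where open Zroupoid Z

-- The variables x, y, z are indexed by Fin 3 (x = 0, y = 1, z = 2);
-- a permutation p of {x,y,z} is a bijection Fin 3 ↔ Fin 3, acting on an
-- assignment v : Fin 3 → A by substitution: p(x) is interpreted as v (p 0) etc.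
IsType1 : ∀ {a} → Zroupoid a → Set a
IsType1 Z =
    (∀ x y → (x ⇒ y) ′ ≡ x ⇒ (𝟎 ⇒ y))
  × (∀ x y → (x ′) ⇒ y ≡ x ⇒ (y ′))
  × (∀ x y → 𝟎 ⇒ (x ⇒ y) ≡ 𝟎 ⇒ (y ⇒ x))
  × Σ (Fin 3 ↔ Fin 3) (λ p →
      let open Inverse p using (to) in
      ∀ (v : Fin 3 → Carrier) →
        v zero ⇒ (v (suc zero) ⇒ v (suc (suc zero)))
          ≡ (v (to zero) ⇒ v (to (suc zero))) ⇒ v (to (suc (suc zero))))
  where open Zroupoid Z

-- In an I-zroupoid with E1–E3 the prime is left multiplication by 0, so 0′ = 0, x ↦ 0 → x is
-- idempotent, and every left-nested product (x → y) → z, being a prime by the defining identity,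
-- is fixed by 0 → _. E4 is used only to see that x → (y → z) is left-nested too, hence also fixed.
-- With E3 this makes x → (y → z) symmetric in y, z and equal to (y → z) → x; the defining identity
-- then yields x → (y → z) ≈ (x → y) → (x → z) and x → (x → y) ≈ 0 → (x → y), whence associativity,
-- which with the two symmetries makes x → (y → z) invariant under all permutations of x, y, z.
module Submission where

open import Defs
open import Level using (Level)
open import Data.Product using (_×_; _,_; proj₁; proj₂)
open import Data.Vec.Functional using ([]; _∷_)
open import Relation.Binary.PropositionalEquality using (_≡_; sym; trans; cong; cong₂; module ≡-Reasoning)
open import Data.Fin using (Fin)

module _ {a} (𝒵 : Zroupoid a) where

  open Zroupoid 𝒵

  module IZroupoidProperties
    (isI : IsIZroupoid 𝒵)
    (e1 : ∀ x y → (x ⇒ y) ′ ≡ x ⇒ 𝟎 ⇒ y)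
    (e2 : ∀ x y → x ′ ⇒ y ≡ x ⇒ y ′)
    (e3 : ∀ x y → 𝟎 ⇒ x ⇒ y ≡ 𝟎 ⇒ y ⇒ x)
    where

    open ≡-Reasoning

    private
      I : ∀ x y z → (x ⇒ y) ⇒ z ≡ ((z ′ ⇒ x) ⇒ (y ⇒ z) ′) ′
      I = proj₁ isI

      𝟎′′≡𝟎 : 𝟎 ′ ′ ≡ 𝟎
      𝟎′′≡𝟎 = proj₂ isI

    𝟎⇒x≡𝟎⇒𝟎⇒x′ : ∀ x → 𝟎 ⇒ x ≡ 𝟎 ⇒ 𝟎 ⇒ x ′
    𝟎⇒x≡𝟎⇒𝟎⇒x′ x = begin
      𝟎 ⇒ x           ≡⟨ cong (_⇒ x) (sym 𝟎′′≡𝟎) ⟩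
      𝟎 ′ ′ ⇒ x       ≡⟨ e2 (𝟎 ′) x ⟩
      𝟎 ′ ⇒ x ′       ≡⟨ e2 𝟎 (x ′) ⟩
      𝟎 ⇒ x ′ ′       ≡⟨ e3 (x ′) 𝟎 ⟩
      𝟎 ⇒ 𝟎 ⇒ x ′     ∎

    𝟎⇒𝟎⇒𝟎⇒x≡𝟎⇒x : ∀ x → 𝟎 ⇒ 𝟎 ⇒ 𝟎 ⇒ x ≡ 𝟎 ⇒ x
    𝟎⇒𝟎⇒𝟎⇒x≡𝟎⇒x x = trans (cong (𝟎 ⇒_) (e3 𝟎 x)) (sym (𝟎⇒x≡𝟎⇒𝟎⇒x′ x))

    x⇒𝟎′≡𝟎⇒𝟎⇒x : ∀ x → x ⇒ 𝟎 ′ ≡ 𝟎 ⇒ 𝟎 ⇒ x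
    x⇒𝟎′≡𝟎⇒𝟎⇒x x = begin
      x ⇒ 𝟎 ′                    ≡⟨ sym (e1 x 𝟎) ⟩
      x ′ ′                      ≡⟨ I x 𝟎 𝟎 ⟩
      ((𝟎 ′ ⇒ x) ⇒ 𝟎 ′ ′) ′      ≡⟨ cong (λ u → ((𝟎 ′ ⇒ x) ⇒ u) ′) 𝟎′′≡𝟎 ⟩
      (𝟎 ′ ⇒ x) ′ ′              ≡⟨ cong (λ u → u ′ ′) (e2 𝟎 x) ⟩
      (𝟎 ⇒ x ′) ′ ′              ≡⟨ cong _′ (e1 𝟎 (x ′)) ⟩
      (𝟎 ⇒ 𝟎 ⇒ x ′) ′            ≡⟨ e1 𝟎 (𝟎 ⇒ x ′) ⟩
      𝟎 ⇒ 𝟎 ⇒ 𝟎 ⇒ x ′            ≡⟨ 𝟎⇒𝟎⇒𝟎⇒x≡𝟎⇒x (x ′) ⟩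
      𝟎 ⇒ x ′                    ≡⟨ e3 x 𝟎 ⟩
      𝟎 ⇒ 𝟎 ⇒ x                  ∎

    x′≡𝟎⇒x : ∀ x → x ′ ≡ 𝟎 ⇒ x
    x′≡𝟎⇒x x = begin
      x ′                ≡⟨ cong (x ⇒_) (sym 𝟎′′≡𝟎) ⟩
      x ⇒ 𝟎 ′ ′          ≡⟨ sym (e2 x (𝟎 ′)) ⟩
      x ′ ⇒ 𝟎 ′          ≡⟨ x⇒𝟎′≡𝟎⇒𝟎⇒x (x ′) ⟩
      𝟎 ⇒ 𝟎 ⇒ x ′        ≡⟨ sym (𝟎⇒x≡𝟎⇒𝟎⇒x′ x) ⟩
      𝟎 ⇒ x              ∎

    𝟎′≡𝟎 : 𝟎 ′ ≡ 𝟎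
    𝟎′≡𝟎 = begin
      𝟎 ′                              ≡⟨ sym 𝟎′⇒𝟎′≡𝟎′ ⟩
      𝟎 ′ ⇒ 𝟎 ′                        ≡⟨ I 𝟎 𝟎 (𝟎 ′) ⟩
      ((𝟎 ′ ′ ⇒ 𝟎) ⇒ (𝟎 ⇒ 𝟎 ′) ′) ′    ≡⟨ cong₂ (λ u v → ((u ⇒ 𝟎) ⇒ v ′) ′) 𝟎′′≡𝟎 𝟎⇒𝟎′≡𝟎 ⟩
      (𝟎 ′ ⇒ 𝟎 ′) ′                    ≡⟨ cong _′ 𝟎′⇒𝟎′≡𝟎′ ⟩
      𝟎 ′ ′                            ≡⟨ 𝟎′′≡𝟎 ⟩
      𝟎                                ∎
      where
      𝟎⇒𝟎′≡𝟎 : 𝟎 ⇒ 𝟎 ′ ≡ 𝟎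
      𝟎⇒𝟎′≡𝟎 = trans (sym (e1 𝟎 𝟎)) 𝟎′′≡𝟎

      𝟎′⇒𝟎′≡𝟎′ : 𝟎 ′ ⇒ 𝟎 ′ ≡ 𝟎 ′
      𝟎′⇒𝟎′≡𝟎′ = trans (x⇒𝟎′≡𝟎⇒𝟎⇒x (𝟎 ′)) (cong (𝟎 ⇒_) 𝟎⇒𝟎′≡𝟎)

    𝟎⇒𝟎⇒x≡𝟎⇒x : ∀ x → 𝟎 ⇒ 𝟎 ⇒ x ≡ 𝟎 ⇒ x
    𝟎⇒𝟎⇒x≡𝟎⇒x x = begin
      𝟎 ⇒ 𝟎 ⇒ x     ≡⟨ sym (x⇒𝟎′≡𝟎⇒𝟎⇒x x) ⟩
      x ⇒ 𝟎 ′       ≡⟨ cong (x ⇒_) 𝟎′≡𝟎 ⟩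
      x ′           ≡⟨ x′≡𝟎⇒x x ⟩
      𝟎 ⇒ x         ∎

    𝟎⇒x⇒y≡x⇒𝟎⇒y : ∀ x y → 𝟎 ⇒ x ⇒ y ≡ x ⇒ 𝟎 ⇒ y
    𝟎⇒x⇒y≡x⇒𝟎⇒y x y = trans (sym (x′≡𝟎⇒x (x ⇒ y))) (e1 x y)

    [𝟎⇒x]⇒y≡𝟎⇒x⇒y : ∀ x y → (𝟎 ⇒ x) ⇒ y ≡ 𝟎 ⇒ x ⇒ y
    [𝟎⇒x]⇒y≡𝟎⇒x⇒y x y = begin
      (𝟎 ⇒ x) ⇒ y     ≡⟨ cong (_⇒ y) (sym (x′≡𝟎⇒x x)) ⟩
      x ′ ⇒ y         ≡⟨ e2 x y ⟩
      x ⇒ y ′         ≡⟨ cong (x ⇒_) (x′≡𝟎⇒x y) ⟩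
      x ⇒ 𝟎 ⇒ y       ≡⟨ sym (𝟎⇒x⇒y≡x⇒𝟎⇒y x y) ⟩
      𝟎 ⇒ x ⇒ y       ∎

    𝟎⇒x′≡x′ : ∀ x → 𝟎 ⇒ x ′ ≡ x ′
    𝟎⇒x′≡x′ x = begin
      𝟎 ⇒ x ′       ≡⟨ cong (𝟎 ⇒_) (x′≡𝟎⇒x x) ⟩
      𝟎 ⇒ 𝟎 ⇒ x     ≡⟨ 𝟎⇒𝟎⇒x≡𝟎⇒x x ⟩
      𝟎 ⇒ x         ≡⟨ sym (x′≡𝟎⇒x x) ⟩
      x ′           ∎

    𝟎⇒[x⇒y]⇒z≡[x⇒y]⇒z : ∀ x y z → 𝟎 ⇒ (x ⇒ y) ⇒ z ≡ (x ⇒ y) ⇒ z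
    𝟎⇒[x⇒y]⇒z≡[x⇒y]⇒z x y z = begin
      𝟎 ⇒ (x ⇒ y) ⇒ z                    ≡⟨ cong (𝟎 ⇒_) (I x y z) ⟩
      𝟎 ⇒ ((z ′ ⇒ x) ⇒ (y ⇒ z) ′) ′      ≡⟨ 𝟎⇒x′≡x′ _ ⟩
      ((z ′ ⇒ x) ⇒ (y ⇒ z) ′) ′          ≡⟨ sym (I x y z) ⟩
      (x ⇒ y) ⇒ z                        ∎

    [x⇒y]⇒z≡𝟎⇒[z⇒x]⇒y⇒z : ∀ x y z → (x ⇒ y) ⇒ z ≡ 𝟎 ⇒ (z ⇒ x) ⇒ y ⇒ z
    [x⇒y]⇒z≡𝟎⇒[z⇒x]⇒y⇒z x y z = begin
      (x ⇒ y) ⇒ z                                 ≡⟨ I x y z ⟩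
      ((z ′ ⇒ x) ⇒ (y ⇒ z) ′) ′                   ≡⟨ x′≡𝟎⇒x _ ⟩
      𝟎 ⇒ (z ′ ⇒ x) ⇒ (y ⇒ z) ′                   ≡⟨ cong₂ (λ u v → 𝟎 ⇒ (u ⇒ x) ⇒ v) (x′≡𝟎⇒x z) (x′≡𝟎⇒x (y ⇒ z)) ⟩
      𝟎 ⇒ ((𝟎 ⇒ z) ⇒ x) ⇒ 𝟎 ⇒ y ⇒ z             ≡⟨ cong (λ u → 𝟎 ⇒ u ⇒ 𝟎 ⇒ y ⇒ z) ([𝟎⇒x]⇒y≡𝟎⇒x⇒y z x) ⟩
      𝟎 ⇒ (𝟎 ⇒ z ⇒ x) ⇒ 𝟎 ⇒ y ⇒ z               ≡⟨ cong (𝟎 ⇒_) ([𝟎⇒x]⇒y≡𝟎⇒x⇒y (z ⇒ x) (𝟎 ⇒ y ⇒ z)) ⟩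
      𝟎 ⇒ 𝟎 ⇒ (z ⇒ x) ⇒ 𝟎 ⇒ y ⇒ z               ≡⟨ 𝟎⇒𝟎⇒x≡𝟎⇒x _ ⟩
      𝟎 ⇒ (z ⇒ x) ⇒ 𝟎 ⇒ y ⇒ z                   ≡⟨ cong (𝟎 ⇒_) (sym (𝟎⇒x⇒y≡x⇒𝟎⇒y (z ⇒ x) (y ⇒ z))) ⟩
      𝟎 ⇒ 𝟎 ⇒ (z ⇒ x) ⇒ y ⇒ z                   ≡⟨ 𝟎⇒𝟎⇒x≡𝟎⇒x _ ⟩
      𝟎 ⇒ (z ⇒ x) ⇒ y ⇒ z                       ∎

    module FixedRightNested
      (𝟎⇒x⇒y⇒z≡x⇒y⇒z : ∀ x y z → 𝟎 ⇒ x ⇒ y ⇒ z ≡ x ⇒ y ⇒ z)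
      where

      x⇒y⇒z≡x⇒z⇒y : ∀ x y z → x ⇒ y ⇒ z ≡ x ⇒ z ⇒ y
      x⇒y⇒z≡x⇒z⇒y x y z = begin
        x ⇒ y ⇒ z         ≡⟨ sym (𝟎⇒x⇒y⇒z≡x⇒y⇒z x y z) ⟩
        𝟎 ⇒ x ⇒ y ⇒ z     ≡⟨ 𝟎⇒x⇒y≡x⇒𝟎⇒y x (y ⇒ z) ⟩
        x ⇒ 𝟎 ⇒ y ⇒ z     ≡⟨ cong (x ⇒_) (e3 y z) ⟩
        x ⇒ 𝟎 ⇒ z ⇒ y     ≡⟨ sym (𝟎⇒x⇒y≡x⇒𝟎⇒y x (z ⇒ y)) ⟩
        𝟎 ⇒ x ⇒ z ⇒ y     ≡⟨ 𝟎⇒x⇒y⇒z≡x⇒y⇒z x z y ⟩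
        x ⇒ z ⇒ y         ∎

      x⇒y⇒z≡[y⇒z]⇒x : ∀ x y z → x ⇒ y ⇒ z ≡ (y ⇒ z) ⇒ x
      x⇒y⇒z≡[y⇒z]⇒x x y z = begin
        x ⇒ y ⇒ z           ≡⟨ sym (𝟎⇒x⇒y⇒z≡x⇒y⇒z x y z) ⟩
        𝟎 ⇒ x ⇒ y ⇒ z       ≡⟨ e3 x (y ⇒ z) ⟩
        𝟎 ⇒ (y ⇒ z) ⇒ x     ≡⟨ 𝟎⇒[x⇒y]⇒z≡[x⇒y]⇒z y z x ⟩
        (y ⇒ z) ⇒ x         ∎

      [x⇒y]⇒z≡[z⇒x]⇒y⇒z : ∀ x y z → (x ⇒ y) ⇒ z ≡ (z ⇒ x) ⇒ y ⇒ z
      [x⇒y]⇒z≡[z⇒x]⇒y⇒z x y z =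
        trans ([x⇒y]⇒z≡𝟎⇒[z⇒x]⇒y⇒z x y z) (𝟎⇒x⇒y⇒z≡x⇒y⇒z (z ⇒ x) y z)

      x⇒x⇒y≡𝟎⇒x⇒y : ∀ x y → x ⇒ x ⇒ y ≡ 𝟎 ⇒ x ⇒ y
      x⇒x⇒y≡𝟎⇒x⇒y x y = sym (begin
        𝟎 ⇒ x ⇒ y             ≡⟨ e3 x y ⟩
        𝟎 ⇒ y ⇒ x             ≡⟨ sym ([𝟎⇒x]⇒y≡𝟎⇒x⇒y y x) ⟩
        (𝟎 ⇒ y) ⇒ x           ≡⟨ cong (_⇒ x) (sym (x′≡𝟎⇒x y)) ⟩
        (y ⇒ 𝟎) ⇒ x           ≡⟨ [x⇒y]⇒z≡[z⇒x]⇒y⇒z y 𝟎 x ⟩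
        (x ⇒ y) ⇒ 𝟎 ⇒ x       ≡⟨ sym (𝟎⇒x⇒y≡x⇒𝟎⇒y (x ⇒ y) x) ⟩
        𝟎 ⇒ (x ⇒ y) ⇒ x       ≡⟨ 𝟎⇒[x⇒y]⇒z≡[x⇒y]⇒z x y x ⟩
        (x ⇒ y) ⇒ x           ≡⟨ sym (x⇒y⇒z≡[y⇒z]⇒x x x y) ⟩
        x ⇒ x ⇒ y             ∎)

      x⇒y⇒z≡[x⇒y]⇒x⇒z : ∀ x y z → x ⇒ y ⇒ z ≡ (x ⇒ y) ⇒ x ⇒ z
      x⇒y⇒z≡[x⇒y]⇒x⇒z x y z = begin
        x ⇒ y ⇒ z           ≡⟨ x⇒y⇒z≡[y⇒z]⇒x x y z ⟩
        (y ⇒ z) ⇒ x         ≡⟨ [x⇒y]⇒z≡[z⇒x]⇒y⇒z y z x ⟩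
        (x ⇒ y) ⇒ z ⇒ x     ≡⟨ x⇒y⇒z≡x⇒z⇒y (x ⇒ y) z x ⟩
        (x ⇒ y) ⇒ x ⇒ z     ∎

      x⇒y⇒z≡[x⇒y]⇒z : ∀ x y z → x ⇒ y ⇒ z ≡ (x ⇒ y) ⇒ z
      x⇒y⇒z≡[x⇒y]⇒z x y z = begin
        x ⇒ y ⇒ z                             ≡⟨ x⇒y⇒z≡[x⇒y]⇒x⇒z x y z ⟩
        (x ⇒ y) ⇒ x ⇒ z                       ≡⟨ x⇒y⇒z≡[x⇒y]⇒x⇒z (x ⇒ y) x z ⟩
        ((x ⇒ y) ⇒ x) ⇒ (x ⇒ y) ⇒ z           ≡⟨ cong (_⇒ (x ⇒ y) ⇒ z) (sym (x⇒y⇒z≡[y⇒z]⇒x x x y)) ⟩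
        (x ⇒ x ⇒ y) ⇒ (x ⇒ y) ⇒ z             ≡⟨ cong (_⇒ (x ⇒ y) ⇒ z) (x⇒x⇒y≡𝟎⇒x⇒y x y) ⟩
        (𝟎 ⇒ x ⇒ y) ⇒ (x ⇒ y) ⇒ z             ≡⟨ [𝟎⇒x]⇒y≡𝟎⇒x⇒y (x ⇒ y) ((x ⇒ y) ⇒ z) ⟩
        𝟎 ⇒ (x ⇒ y) ⇒ (x ⇒ y) ⇒ z             ≡⟨ cong (𝟎 ⇒_) (x⇒x⇒y≡𝟎⇒x⇒y (x ⇒ y) z) ⟩
        𝟎 ⇒ 𝟎 ⇒ (x ⇒ y) ⇒ z                   ≡⟨ 𝟎⇒𝟎⇒x≡𝟎⇒x _ ⟩
        𝟎 ⇒ (x ⇒ y) ⇒ z                       ≡⟨ 𝟎⇒[x⇒y]⇒z≡[x⇒y]⇒z x y z ⟩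
        (x ⇒ y) ⇒ z                           ∎

      x⇒y⇒z≡z⇒x⇒y : ∀ x y z → x ⇒ y ⇒ z ≡ z ⇒ x ⇒ y
      x⇒y⇒z≡z⇒x⇒y x y z = trans (x⇒y⇒z≡[x⇒y]⇒z x y z) (sym (x⇒y⇒z≡[y⇒z]⇒x z x y))

      x⇒y⇒z≡y⇒x⇒z : ∀ x y z → x ⇒ y ⇒ z ≡ y ⇒ x ⇒ z
      x⇒y⇒z≡y⇒x⇒z x y z = trans (x⇒y⇒z≡x⇒z⇒y x y z) (x⇒y⇒z≡z⇒x⇒y x z y)

      x⇒y⇒z≡y⇒z⇒x : ∀ x y z → x ⇒ y ⇒ z ≡ y ⇒ z ⇒ x
      x⇒y⇒z≡y⇒z⇒x x y z = trans (x⇒y⇒z≡y⇒x⇒z x y z) (x⇒y⇒z≡x⇒z⇒y y x z)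

      x⇒y⇒z≡z⇒y⇒x : ∀ x y z → x ⇒ y ⇒ z ≡ z ⇒ y ⇒ x
      x⇒y⇒z≡z⇒y⇒x x y z = trans (x⇒y⇒z≡z⇒x⇒y x y z) (x⇒y⇒z≡x⇒z⇒y z x y)

      x⇒y⇒z≡[x⇒z]⇒y : ∀ x y z → x ⇒ y ⇒ z ≡ (x ⇒ z) ⇒ y
      x⇒y⇒z≡[x⇒z]⇒y x y z = trans (x⇒y⇒z≡x⇒z⇒y x y z) (x⇒y⇒z≡[x⇒y]⇒z x z y)

      x⇒y⇒z≡[y⇒x]⇒z : ∀ x y z → x ⇒ y ⇒ z ≡ (y ⇒ x) ⇒ z
      x⇒y⇒z≡[y⇒x]⇒z x y z = trans (x⇒y⇒z≡y⇒x⇒z x y z) (x⇒y⇒z≡[x⇒y]⇒z y x z)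

      x⇒y⇒z≡[z⇒x]⇒y : ∀ x y z → x ⇒ y ⇒ z ≡ (z ⇒ x) ⇒ y
      x⇒y⇒z≡[z⇒x]⇒y x y z = trans (x⇒y⇒z≡z⇒x⇒y x y z) (x⇒y⇒z≡[x⇒y]⇒z z x y)

      x⇒y⇒z≡[z⇒y]⇒x : ∀ x y z → x ⇒ y ⇒ z ≡ (z ⇒ y) ⇒ x
      x⇒y⇒z≡[z⇒y]⇒x x y z = trans (x⇒y⇒z≡z⇒y⇒x x y z) (x⇒y⇒z≡[x⇒y]⇒z z y x)

    𝟎⇒x⇒y⇒z≡x⇒y⇒z : IsType1 𝒵 → ∀ x y z → 𝟎 ⇒ x ⇒ y ⇒ z ≡ x ⇒ y ⇒ z
    𝟎⇒x⇒y⇒z≡x⇒y⇒z (_ , _ , _ , _ , e4) x y z =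
      trans (cong (𝟎 ⇒_) (e4 v)) (trans (𝟎⇒[x⇒y]⇒z≡[x⇒y]⇒z _ _ _) (sym (e4 v)))
      where
      v : Fin 3 → Carrier
      v = x ∷ y ∷ z ∷ []

theorem3p7 : ∀ {a : Level} (Z : Zroupoid a) → IsIZroupoid Z → IsType1 Z →
    let open Zroupoid Z in
      (∀ x y z → x ⇒ (y ⇒ z) ≡ (x ⇒ y) ⇒ z)
    × (∀ x y z → x ⇒ (y ⇒ z) ≡ x ⇒ (z ⇒ y))
    × (∀ x y z → x ⇒ (y ⇒ z) ≡ (x ⇒ z) ⇒ y)
    × (∀ x y z → x ⇒ (y ⇒ z) ≡ y ⇒ (x ⇒ z))
    × (∀ x y z → x ⇒ (y ⇒ z) ≡ (y ⇒ x) ⇒ z)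
    × (∀ x y z → x ⇒ (y ⇒ z) ≡ y ⇒ (z ⇒ x))
    × (∀ x y z → x ⇒ (y ⇒ z) ≡ (y ⇒ z) ⇒ x)
    × (∀ x y z → x ⇒ (y ⇒ z) ≡ (z ⇒ x) ⇒ y)
    × (∀ x y z → x ⇒ (y ⇒ z) ≡ z ⇒ (y ⇒ x))
    × (∀ x y z → x ⇒ (y ⇒ z) ≡ (z ⇒ y) ⇒ x)
    × (∀ x y z → (x ⇒ y) ⇒ z ≡ (x ⇒ z) ⇒ y)
    × (∀ x y z → (x ⇒ y) ⇒ z ≡ (y ⇒ x) ⇒ z)
    × (∀ x y z → (x ⇒ y) ⇒ z ≡ (y ⇒ z) ⇒ x)
    × (∀ x y z → (x ⇒ y) ⇒ z ≡ (z ⇒ y) ⇒ x)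
theorem3p7 Z isI type1@(e1 , e2 , e3 , _) =
    A1 , A2 , A3 , A4 , A5 , A6 , A7 , A8 , A9 , A10
  , (λ x y z → trans (sym (A1 x y z)) (A3 x y z))
  , (λ x y z → trans (sym (A1 x y z)) (A5 x y z))
  , (λ x y z → trans (sym (A1 x y z)) (A7 x y z))
  , (λ x y z → trans (sym (A1 x y z)) (A10 x y z))
  where
  open IZroupoidProperties Z isI e1 e2 e3
  open FixedRightNested (𝟎⇒x⇒y⇒z≡x⇒y⇒z type1) renaming
    ( x⇒y⇒z≡[x⇒y]⇒z to A1 ; x⇒y⇒z≡x⇒z⇒y to A2 ; x⇒y⇒z≡[x⇒z]⇒y to A3
    ; x⇒y⇒z≡y⇒x⇒z to A4 ; x⇒y⇒z≡[y⇒x]⇒z to A5 ; x⇒y⇒z≡y⇒z⇒x to A6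
    ; x⇒y⇒z≡[y⇒z]⇒x to A7 ; x⇒y⇒z≡[z⇒x]⇒y to A8 ; x⇒y⇒z≡z⇒y⇒x to A9
    ; x⇒y⇒z≡[z⇒y]⇒x to A10 )
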